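{- Let $\Sigma$ be a fixed finite alphabet with at least two letters. Then $\mathcal{P}_3(n) \in \Omega(n^{3/2})$, where $\mathcal{P}_3(n) = \max\{ |\mathrm{Pal}(T)| : T \in \mathcal{T}_3,\ |T| \le n\}$.
   Context: A tree is a finite undirected, acyclic, connected graph; here every edge is labeled by a letter of the finite alphabet $\Sigma$. For nodes $x,y$, $\pi(x,y)\in\Sigma^*$ is the word of labels read along the unique simple path from $x$ to $y$ ($\pi(x,x)$ is the empty word). The language of $T$ is $\mathcal{L}(T)=\{\pi(x,y): x,y \text{ nodes of } T\}$, and $\mathrm{Pal}(T)=\{w\in\mathcal{L}(T): w=\widetilde{w}\}$, where $\widetilde w$ is the reversal of $w$. The size $|T|$ is the number of edges. For a word $w$, $|\Delta(w)|$ denotes the number of maximal blocks of equal consecutive letters in $w$ (length of its run-length encoding). $\mathcal{T}_k$ is the set of labeled trees $T$ with $|\Delta(f)|\le k$ for all $f\in\mathcal{L}(T)$, and $\mathcal{P}_k(n)=\max_{T\in\mathcal{T}_k,\,|T|\le n}|\mathrm{Pal}(T)|$. -}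

module Defs where

open import Data.Nat using (ℕ; zero; suc; _≤_; _*_; _^_)
open import Data.Fin using (Fin; toℕ; _≟_)
import Data.Fin as F
open import Data.List using (List; []; _∷_; length; reverse)
open import Data.List.Relation.Unary.All using (All)
open import Data.List.Relation.Unary.Unique.Propositional using (Unique)
open import Data.Product using (Σ; ∃; ∃-syntax; _×_; _,_)
open import Data.Sum using (_⊎_)
open import Relation.Binary.PropositionalEquality using (_≡_)
open import Relation.Nullary using (does)
open import Data.Bool using (if_then_else_)

-- Alphabet: Σ = Fin s (any finite alphabet is, up to renaming, of this form).
Word : ℕ → Set
Word s = List (Fin s)

-- An edge-labelled tree with m edges and nodes Fin (suc m), rooted at node 0:
-- for each i : Fin m, the edge i joins node (suc i) to node (parent i),
-- where parent i has index ≤ i, and carries label (label i).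
-- Every finite labelled tree with m edges is isomorphic to one of this form
-- (number nodes in BFS order from any root); conversely every such structure
-- is a tree (connected, m+1 nodes, m edges).
record LTree (s m : ℕ) : Set where
  field
    parent    : Fin m → Fin (suc m)
    parent≤   : (i : Fin m) → toℕ (parent i) ≤ toℕ i
    label     : Fin m → Fin s
open LTree public

Node : ℕ → Set
Node m = Fin (suc m)

Step : ∀ {s m} → LTree s m → Node m → Fin s → Node m → Set
Step T x a y = ∃[ i ] (((x ≡ F.suc i × y ≡ parent T i) ⊎ (x ≡ parent T i × y ≡ F.suc i))
                       × label T i ≡ a)

data Walk {s m} (T : LTree s m) : Node m → Node m → Word s → Set where
  here : ∀ {x} → Walk T x x []
  step : ∀ {x y z a w} → Step T x a y → Walk T y z w → Walk T x z (a ∷ w)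

vertices : ∀ {s m} {T : LTree s m} {x y w} → Walk T x y w → List (Node m)
vertices {x = x} here = x ∷ []
vertices {x = x} (step _ p) = x ∷ vertices p

IsPathWord : ∀ {s m} → LTree s m → Node m → Node m → Word s → Set
IsPathWord T x y w = Σ (Walk T x y w) λ p → Unique (vertices p)

InLang : ∀ {s m} → LTree s m → Word s → Set
InLang T w = ∃[ x ] ∃[ y ] IsPathWord T x y w

IsPalindrome : ∀ {s} → Word s → Set
IsPalindrome w = w ≡ reverse w

runs : ∀ {s} → Word s → ℕ
runs [] = 0
runs (a ∷ []) = 1
runs (a ∷ b ∷ w) = if does (a ≟ b) then runs (b ∷ w) else suc (runs (b ∷ w))

InTk : ∀ {s m} → ℕ → LTree s m → Set
InTk k T = ∀ w → InLang T w → runs w ≤ k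

-- |Pal(T)| ≥ length ws : ws is a duplicate-free list of palindromes of L(T)
PalList : ∀ {s m} → LTree s m → List (Word _) → Set
PalList {s} T ws = Unique ws × All (λ w → InLang T w × IsPalindrome {s} w) ws

-- A tree whose b-labelled edges form a subtree containing the root, all other edges being
-- labelled a, reads only words of a*b*a* along its paths, hence lies in 𝒯₃.  Take a b-path
-- (the spine) of length K² and hang 2K a-paths (legs) of length K from it: leg F_r from
-- the spine node k ∸ r and leg C_q from the spine node k + qK, for r, q ≤ k = K − 1.  Writing
-- j < K² as r + qK, the feet of F_r and C_q are j apart on the spine, so the path between
-- the nodes at depth i + 1 of F_r and of C_q reads the palindrome a^(i+1) b^j a^(i+1).  This
-- gives K³ distinct palindromes in a tree with 3K² edges; taking K maximal with 3K² ≤ n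
-- yields n < 3(K + 1)² ≤ 12K², so |Pal| ≥ K³ > (n/12)^(3/2).
module Submission where

open import Defs
open import Data.Nat using (ℕ; zero; suc; _≤_; _<_; _+_; _∸_; _*_; _^_; z≤n; s≤s; _<?_; _≤?_; NonZero)
open import Data.Nat.Properties hiding (_≟_; <⇒≢)
open import Data.Nat.DivMod using (_mod_; _%_; _/_; m%n<n; m<n⇒m%n≡m; m<n*o⇒m/o<n; m≡m%n+[m/n]*n)
open import Data.Nat.Tactic.RingSolver using (solve-∀)
open import Data.Fin using (Fin; zero; suc; toℕ; _≟_)
open import Data.Fin.Properties using (<⇒≢; toℕ-injective; toℕ-fromℕ<; toℕ<n)
open import Data.List
  using (List; []; _∷_; replicate; _++_; _∷ʳ_; reverse; length; filter; map; cartesianProduct; upTo)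
open import Data.List.Properties
  using (length-++; length-replicate; length-map; length-upTo; unfold-reverse; reverse-++; ++-assoc;
         ++-identityʳ; filter-++; filter-all; filter-none)
open import Data.List.Membership.Propositional.Properties using (∈-cartesianProduct⁻; ∈-upTo⁻)
open import Data.List.Relation.Unary.All using (All; []; _∷_)
import Data.List.Relation.Unary.All as All
import Data.List.Relation.Unary.All.Properties as Allₚ
open import Data.List.Relation.Unary.AllPairs using (AllPairs; []; _∷_)
import Data.List.Relation.Unary.AllPairs as AllPairs
open import Data.List.Relation.Unary.Unique.Propositional using (Unique)
import Data.List.Relation.Unary.Unique.Propositional.Properties as Uniqueₚ
open import Data.Product using (Σ; ∃-syntax; _×_; _,_; proj₁; proj₂)
open import Data.Sum using (_⊎_; inj₁; inj₂)
open import Data.Bool using (true; false)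
open import Data.Empty using (⊥-elim)
open import Function using (_∘_)
open import Relation.Nullary using (does; yes; no; contradiction)
open import Relation.Nullary.Decidable using (dec-true)
open import Relation.Binary.PropositionalEquality
  using (_≡_; _≢_; refl; sym; trans; cong; cong₂; subst; subst₂; ≢-sym)
open import Relation.Binary.PropositionalEquality.Properties using (module ≡-Reasoning)

runs-dup : ∀ {s} (x : Fin s) w → runs (x ∷ x ∷ w) ≡ runs (x ∷ w)
runs-dup x w rewrite dec-true (x ≟ x) refl = refl

runs-∷-≤ : ∀ {s} (x : Fin s) w → runs (x ∷ w) ≤ suc (runs w)
runs-∷-≤ x []      = ≤-refl
runs-∷-≤ x (y ∷ w) with does (x ≟ y)
... | true  = n≤1+n _
... | false = ≤-refl

runs-≤-∷ : ∀ {s} (x : Fin s) w → runs w ≤ runs (x ∷ w)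
runs-≤-∷ x []      = z≤n
runs-≤-∷ x (y ∷ w) with does (x ≟ y)
... | true  = ≤-refl
... | false = n≤1+n _

module _ {s m} {T : LTree s m} where

  infixr 5 _▻_

  _▻_ : ∀ {x y z u v} → Walk T x y u → Walk T y z v → Walk T x z (u ++ v)
  here       ▻ q = q
  step st p ▻ q = step st (p ▻ q)

  departures : ∀ {x y w} → Walk T x y w → List (Node m)
  departures here                = []
  departures {x = x} (step _ p) = x ∷ departures p

  All-vertices-head : ∀ {P : Node m → Set} {x y w} (p : Walk T x y w) → All P (vertices p) → P x
  All-vertices-head here       (px ∷ _) = px
  All-vertices-head (step _ _) (px ∷ _) = px

  All-departures : ∀ {P : Node m → Set} {x y w} (p : Walk T x y w) →
                   All P (vertices p) → All P (departures p)
  All-departures here       _          = []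
  All-departures (step _ p) (px ∷ pxs) = px ∷ All-departures p pxs

  All-▻ : ∀ {P : Node m → Set} {x y z u v} (p : Walk T x y u) {q : Walk T y z v} →
          All P (departures p) → All P (vertices q) → All P (vertices (p ▻ q))
  All-▻ here       []         pq = pq
  All-▻ (step _ p) (px ∷ pxs) pq = px ∷ All-▻ p pxs pq

  Ascending Descending : ∀ {x y w} → Walk T x y w → Set
  Ascending  p = AllPairs (λ u v → toℕ u < toℕ v) (vertices p)
  Descending p = AllPairs (λ u v → toℕ v < toℕ u) (vertices p)

  ascending-lower : ∀ {x y w} (p : Walk T x y w) → Ascending p →
                    All (λ v → toℕ x ≤ toℕ v) (vertices p)
  ascending-lower here       _        = ≤-refl ∷ []
  ascending-lower (step _ _) (x< ∷ _) = ≤-refl ∷ All.map <⇒≤ x<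

  descending-upper : ∀ {x y w} (p : Walk T x y w) → Descending p →
                     All (λ v → toℕ v ≤ toℕ x) (vertices p)
  descending-upper here       _        = ≤-refl ∷ []
  descending-upper (step _ _) (x> ∷ _) = ≤-refl ∷ All.map <⇒≤ x>

  ascending-upper : ∀ {x y w} (p : Walk T x y w) → Ascending p →
                    All (λ v → toℕ v ≤ toℕ y) (vertices p)
  ascending-upper here       _          = ≤-refl ∷ []
  ascending-upper (step _ p) (x< ∷ asc) =
    <⇒≤ (<-≤-trans (All-vertices-head p x<) (All-vertices-head p p≤y)) ∷ p≤y
    where
    p≤y : All (λ v → toℕ v ≤ toℕ _) (vertices p)
    p≤y = ascending-upper p asc

  ascending-▻ : ∀ {x y z u v} (p : Walk T x y u) (q : Walk T y z v) →
                Ascending p → Ascending q → Ascending (p ▻ q)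
  ascending-▻ here       q _          aq = aq
  ascending-▻ (step _ p) q (x< ∷ asc) aq =
    All.map (<-≤-trans (All-vertices-head p x<)) (ascending-lower (p ▻ q) rest) ∷ rest
    where
    rest : Ascending (p ▻ q)
    rest = ascending-▻ p q asc aq

  ascending⇒simple : ∀ {x y w} (p : Walk T x y w) → Ascending p → Unique (vertices p)
  ascending⇒simple _ = AllPairs.map <⇒≢

  valley⇒simple : ∀ {B x y z u v} (p : Walk T x y u) (q : Walk T y z v) →
                  Descending p → All (λ v → B < toℕ v) (departures p) →
                  Unique (vertices q) → All (λ v → toℕ v ≤ B) (vertices q) →
                  Unique (vertices (p ▻ q))
  valley⇒simple here       q _          _          uq _   = uq
  valley⇒simple (step _ p) q (x> ∷ desc) (B<x ∷ B<) uq q≤B =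
    All-▻ p (All-departures p (All.map (λ v<x → ≢-sym (<⇒≢ v<x)) x>))
            (All.map (λ v≤B → ≢-sym (<⇒≢ (≤-<-trans v≤B B<x))) q≤B)
    ∷ valley⇒simple p q desc B< uq q≤B

upLabel : ∀ {s m} → Fin s → LTree s m → Node m → Fin s
upLabel b T zero    = b
upLabel b T (suc i) = label T i

-- A simple path first climbs, reading a's until its first b (all edges above a b-edge are b),
-- then descends, reading b's until its first a (all edges below an a-edge are a).
module _ {s m} (T : LTree s m) {a b : Fin s} (a≢b : a ≢ b)
         (two-letters : ∀ i → label T i ≡ a ⊎ label T i ≡ b)
         (b-upward-closed : ∀ i → label T i ≡ b → upLabel b T (parent T i) ≡ b) where

  private
    runs-below : ∀ {x z w} (p : Walk T x z w) → Unique (vertices p) →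
                 ∀ i → x ≡ suc i → All (parent T i ≢_) (vertices p) →
                 (label T i ≡ a → runs (a ∷ w) ≤ 1) × runs (b ∷ w) ≤ 2
    runs-below here _ _ _ _ = (λ _ → ≤-refl) , s≤s z≤n
    runs-below (step (j , inj₁ (refl , refl) , refl) p) _ .j refl (_ ∷ avoid) =
      ⊥-elim (All-vertices-head p avoid refl)
    runs-below {w = _ ∷ w} (step (j , inj₂ (refl , refl) , refl) p) (fresh ∷ u) i x≡ _
      with runs-below p u j refl fresh | two-letters j
    ... | below-a , _ | inj₁ ja rewrite ja =
      (λ _ → subst (_≤ 1) (sym (runs-dup a w)) (below-a refl)) ,
      ≤-trans (runs-∷-≤ b (a ∷ w)) (s≤s (below-a refl))
    ... | _ , below-b | inj₂ jb rewrite jb =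
      (λ ia → ⊥-elim (a≢b (trans (sym ia) (trans (cong (upLabel b T) (sym x≡)) (b-upward-closed j jb))))) ,
      subst (_≤ 2) (sym (runs-dup b w)) below-b

    runs-simple : ∀ {x z w} (p : Walk T x z w) → Unique (vertices p) →
                  runs (a ∷ w) ≤ 3 × (upLabel b T x ≡ b → runs (b ∷ w) ≤ 2)
    runs-simple here _ = s≤s z≤n , λ _ → s≤s z≤n
    runs-simple {w = _ ∷ w} (step (j , inj₁ (refl , refl) , refl) p) (_ ∷ u)
      with runs-simple p u | two-letters j
    ... | above-a , _ | inj₁ ja rewrite ja =
      subst (_≤ 3) (sym (runs-dup a w)) above-a , λ ab → ⊥-elim (a≢b ab)
    ... | _ , above-b | inj₂ jb rewrite jb =
      ≤-trans (runs-∷-≤ a (b ∷ w)) (s≤s (above-b (b-upward-closed j jb))) ,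
      λ _ → subst (_≤ 2) (sym (runs-dup b w)) (above-b (b-upward-closed j jb))
    runs-simple {w = _ ∷ w} (step (j , inj₂ (refl , refl) , refl) p) (fresh ∷ u)
      with runs-below p u j refl fresh | two-letters j
    ... | below-a , _ | inj₁ ja rewrite ja =
      subst (_≤ 3) (sym (runs-dup a w)) (≤-trans (below-a refl) (s≤s z≤n)) ,
      λ _ → ≤-trans (runs-∷-≤ b (a ∷ w)) (s≤s (below-a refl))
    ... | _ , below-b | inj₂ jb rewrite jb =
      ≤-trans (runs-∷-≤ a (b ∷ w)) (s≤s below-b) ,
      λ _ → subst (_≤ 2) (sym (runs-dup b w)) below-b

  upwardClosed⇒InTk3 : InTk 3 T
  upwardClosed⇒InTk3 w (_ , _ , p , u) = ≤-trans (runs-≤-∷ a w) (proj₁ (runs-simple p u))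

record Chain {s m} (T : LTree s m) (c : Fin s) (len : ℕ) : Set where
  field
    node        : ℕ → Node m
    edge        : ℕ → Fin m
    parent-edge : ∀ {t} → t < len → parent T (edge t) ≡ node t
    suc-edge    : ∀ {t} → t < len → suc (edge t) ≡ node (suc t)
    label-edge  : ∀ {t} → t < len → label T (edge t) ≡ c

  step-down : ∀ {t} → t < len → Step T (node t) c (node (suc t))
  step-down t<len = edge _ , inj₂ (sym (parent-edge t<len) , sym (suc-edge t<len)) , label-edge t<len

  step-up : ∀ {t} → t < len → Step T (node (suc t)) c (node t)
  step-up t<len = edge _ , inj₁ (sym (suc-edge t<len) , sym (parent-edge t<len)) , label-edge t<len

  node-< : ∀ {t} → t < len → toℕ (node t) < toℕ (node (suc t))
  node-< {t} t<len = subst₂ (λ u v → toℕ u < toℕ v) (parent-edge t<len) (suc-edge t<len)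
                            (s≤s (parent≤ T (edge t)))

  descend : ∀ t n → n + t ≤ len → Σ (Walk T (node t) (node (n + t)) (replicate n c)) Ascending
  descend t zero    _  = here , [] ∷ []
  descend t (suc n) le
    with subst (λ u → Σ (Walk T (node (suc t)) (node u) (replicate n c)) Ascending) (+-suc n t)
               (descend (suc t) n (≤-trans (≤-reflexive (+-suc n t)) le))
  ... | p , asc = step (step-down t<len) p ,
                  All.map (<-≤-trans (node-< t<len)) (ascending-lower p asc) ∷ asc
    where
    t<len : t < len
    t<len = <-≤-trans (s≤s (m≤n+m t n)) le

  ascend : ∀ n → n ≤ len → Walk T (node n) (node 0) (replicate n c)
  ascend zero    _  = here
  ascend (suc n) le = step (step-up le) (ascend n (<⇒≤ le))

  ascend-descending : ∀ n (le : n ≤ len) → Descending (ascend n le)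
  ascend-descending zero    _  = [] ∷ []
  ascend-descending (suc n) le =
    All.map (λ v≤ → ≤-<-trans v≤ (node-< le)) (descending-upper (ascend n _) rest) ∷ rest
    where
    rest : Descending (ascend n (<⇒≤ le))
    rest = ascend-descending n (<⇒≤ le)

  ascend-departures : ∀ {P : Node m → Set} n (le : n ≤ len) →
                      (∀ {t} → t < n → P (node (suc t))) → All P (departures (ascend n le))
  ascend-departures zero    _  _ = []
  ascend-departures (suc n) le P-node =
    P-node ≤-refl ∷ ascend-departures n _ (λ t<n → P-node (m≤n⇒m≤1+n t<n))

replicate-∷ʳ : ∀ {A : Set} n (x : A) → replicate n x ∷ʳ x ≡ x ∷ replicate n x
replicate-∷ʳ zero    x = refl
replicate-∷ʳ (suc n) x = cong (x ∷_) (replicate-∷ʳ n x)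

reverse-replicate : ∀ {A : Set} n (x : A) → reverse (replicate n x) ≡ replicate n x
reverse-replicate zero    x = refl
reverse-replicate (suc n) x = begin
  reverse (x ∷ replicate n x)   ≡⟨ unfold-reverse x (replicate n x) ⟩
  reverse (replicate n x) ∷ʳ x  ≡⟨ cong (_∷ʳ x) (reverse-replicate n x) ⟩
  replicate n x ∷ʳ x            ≡⟨ replicate-∷ʳ n x ⟩
  x ∷ replicate n x             ∎
  where open ≡-Reasoning

sandwich : ∀ {s} → Fin s → Fin s → ℕ → ℕ → Word s
sandwich a b i j = replicate i a ++ replicate j b ++ replicate i a

sandwich-palindrome : ∀ {s} (a b : Fin s) i j → IsPalindrome (sandwich a b i j)
sandwich-palindrome {s} a b i j = sym (begin
  reverse (u ++ v ++ u)          ≡⟨ reverse-++ u (v ++ u) ⟩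
  reverse (v ++ u) ++ reverse u  ≡⟨ cong₂ _++_ (reverse-++ v u) (reverse-replicate i a) ⟩
  (reverse u ++ reverse v) ++ u  ≡⟨ cong₂ (λ x y → (x ++ y) ++ u) (reverse-replicate i a)
                                                                  (reverse-replicate j b) ⟩
  (u ++ v) ++ u                  ≡⟨ ++-assoc u v u ⟩
  u ++ v ++ u                    ∎)
  where
  open ≡-Reasoning
  u v : Word s
  u = replicate i a
  v = replicate j b

module _ {s} {a b : Fin s} (a≢b : a ≢ b) where

  filter-sandwich : ∀ i j → filter (_≟ b) (sandwich a b i j) ≡ replicate j b
  filter-sandwich i j = begin
    filter (_≟ b) (u ++ v ++ u)                            ≡⟨ filter-++ (_≟ b) u (v ++ u) ⟩
    filter (_≟ b) u ++ filter (_≟ b) (v ++ u)              ≡⟨ cong (filter (_≟ b) u ++_) (filter-++ (_≟ b) v u) ⟩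
    filter (_≟ b) u ++ filter (_≟ b) v ++ filter (_≟ b) u  ≡⟨ cong₂ (λ x y → x ++ y ++ x) no-b all-b ⟩
    v ++ []                                                ≡⟨ ++-identityʳ v ⟩
    v                                                      ∎
    where
    open ≡-Reasoning
    u v : Word s
    u = replicate i a
    v = replicate j b
    no-b : filter (_≟ b) u ≡ []
    no-b = filter-none (_≟ b) (Allₚ.replicate⁺ i a≢b)
    all-b : filter (_≟ b) v ≡ v
    all-b = filter-all (_≟ b) (Allₚ.replicate⁺ j refl)

  length-sandwich : ∀ i j → length (sandwich a b i j) ≡ j + 2 * i
  length-sandwich i j = begin
    length (u ++ v ++ u)                   ≡⟨ length-++ u ⟩
    length u + length (v ++ u)             ≡⟨ cong (length u +_) (length-++ v) ⟩
    length u + (length v + length u)       ≡⟨ cong₂ (λ x y → x + (y + x)) (length-replicate i)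
                                                                          (length-replicate j) ⟩
    i + (j + i)                            ≡⟨ rearrange i j ⟩
    j + 2 * i                              ∎
    where
    open ≡-Reasoning
    u v : Word s
    u = replicate i a
    v = replicate j b
    rearrange : ∀ x y → x + (y + x) ≡ y + 2 * x
    rearrange = solve-∀

  sandwich-injective : ∀ {i j i′ j′} → sandwich a b i j ≡ sandwich a b i′ j′ → i ≡ i′ × j ≡ j′
  sandwich-injective {i} {j} {i′} {j′} eq = i≡i′ , j≡j′
    where
    j≡j′ : j ≡ j′
    j≡j′ = begin
      j                                          ≡⟨ length-replicate j ⟨
      length (replicate j b)                     ≡⟨ cong length (filter-sandwich i j) ⟨
      length (filter (_≟ b) (sandwich a b i j))  ≡⟨ cong (length ∘ filter (_≟ b)) eq ⟩
      length (filter (_≟ b) (sandwich a b i′ j′)) ≡⟨ cong length (filter-sandwich i′ j′) ⟩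
      length (replicate j′ b)                    ≡⟨ length-replicate j′ ⟩
      j′                                         ∎
      where open ≡-Reasoning
    i≡i′ : i ≡ i′
    i≡i′ = *-cancelˡ-≡ i i′ 2 (+-cancelˡ-≡ j (2 * i) (2 * i′) (begin
      j + 2 * i                       ≡⟨ length-sandwich i j ⟨
      length (sandwich a b i j)       ≡⟨ cong length eq ⟩
      length (sandwich a b i′ j′)     ≡⟨ length-sandwich i′ j′ ⟩
      j′ + 2 * i′                     ≡⟨ cong (_+ 2 * i′) j≡j′ ⟨
      j + 2 * i′                      ∎))
      where open ≡-Reasoning

length-cartesianProduct : ∀ {A B : Set} (xs : List A) (ys : List B) →
                          length (cartesianProduct xs ys) ≡ length xs * length ys
length-cartesianProduct []       ys = refl
length-cartesianProduct (x ∷ xs) ys = begin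
  length (map (x ,_) ys ++ cartesianProduct xs ys)          ≡⟨ length-++ (map (x ,_) ys) ⟩
  length (map (x ,_) ys) + length (cartesianProduct xs ys)  ≡⟨ cong₂ _+_ (length-map (x ,_) ys)
                                                                        (length-cartesianProduct xs ys) ⟩
  length ys + length xs * length ys                         ∎
  where open ≡-Reasoning

floor-inverse : (f : ℕ → ℕ) → (∀ k → f k < f (suc k)) →
                ∀ n → f 0 ≤ n → ∃[ k ] (f k ≤ n × n < f (suc k))
floor-inverse f f-< zero f0≤0 = 0 , f0≤0 , ≤-<-trans z≤n (f-< 0)
floor-inverse f f-< (suc n) f0≤1+n with f 0 ≤? n
... | no f0≰n = 0 , f0≤1+n , ≤-<-trans (≰⇒> f0≰n) (f-< 0)
... | yes f0≤n with floor-inverse f f-< n f0≤n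
...   | k , fk≤n , n<f1+k with f (suc k) ≤? suc n
...     | yes f1+k≤1+n = suc k , f1+k≤1+n , ≤-<-trans n<f1+k (f-< (suc k))
...     | no f1+k≰1+n  = k , m≤n⇒m≤1+n fk≤n , ≰⇒> f1+k≰1+n

toℕ-mod : ∀ {e n} .{{_ : NonZero n}} → e < n → toℕ (e mod n) ≡ e
toℕ-mod {e} {n} e<n = trans (toℕ-fromℕ< (m%n<n e n)) (m<n⇒m%n≡m e<n)

-- The edges e < M form the spine 0 − 1 − ⋯ − M; the
-- legs C_q (offset O = M, foot attachC q) and F_l (offset O = M + M, foot attachF l) have
-- the edge t * K + (O + l) at depth t, and legNode O attach l t is their node at depth t.
module Construction (k : ℕ) where

  K M m : ℕ
  K = suc k
  M = K * K
  m = (M + M) + M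

  attachC attachF : ℕ → ℕ
  attachC q = k + q * K
  attachF l = k ∸ l

  legNode : ℕ → (ℕ → ℕ) → ℕ → ℕ → ℕ
  legNode O attach l zero    = attach l
  legNode O attach l (suc t) = suc (t * K + (O + l))

  legParent : ℕ → (ℕ → ℕ) → ℕ → ℕ
  legParent O attach e with e <? O + K
  ... | yes _ = attach (e ∸ O)
  ... | no _  = e ∸ k

  par : ℕ → ℕ
  par e with e <? M
  ... | yes _ = e
  ... | no _ with e <? M + M
  ...   | yes _ = legParent M attachC e
  ...   | no _  = legParent (M + M) attachF e

  attachC-< : ∀ {q} → q < K → attachC q < M
  attachC-< (s≤s q≤k) = s≤s (+-monoʳ-≤ k (*-monoˡ-≤ K q≤k))

  attachF-≤ : ∀ l → attachF l ≤ M + M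
  attachF-≤ l = ≤-trans (m∸n≤m k l) (≤-trans (n≤1+n k) (≤-trans (m≤m+n K (k * K)) (m≤m+n M M)))

  legParent-≤ : ∀ {O attach e} → (∀ {l} → l < K → attach l ≤ O) → O ≤ e → legParent O attach e ≤ e
  legParent-≤ {O} {attach} {e} attach≤ O≤e with e <? O + K
  ... | yes e<O+K = ≤-trans (attach≤ (subst (e ∸ O <_) (m+n∸m≡n O K) (∸-monoˡ-< e<O+K O≤e))) O≤e
  ... | no _      = m∸n≤m e k

  par-≤ : ∀ e → par e ≤ e
  par-≤ e with e <? M
  ... | yes _ = ≤-refl
  ... | no e≮M with e <? M + M
  ...   | yes _    = legParent-≤ (λ q<K → <⇒≤ (attachC-< q<K)) (≮⇒≥ e≮M)
  ...   | no e≮2M  = legParent-≤ (λ {l} _ → attachF-≤ l) (≮⇒≥ e≮2M)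

  par-spine : ∀ {e} → e < M → par e ≡ e
  par-spine {e} e<M with e <? M
  ... | yes _   = refl
  ... | no e≮M = contradiction e<M e≮M

  par-legC : ∀ {e} → M ≤ e → e < M + M → par e ≡ legParent M attachC e
  par-legC {e} M≤e e<2M with e <? M
  ... | yes e<M = contradiction e<M (≤⇒≯ M≤e)
  ... | no _ with e <? M + M
  ...   | yes _    = refl
  ...   | no e≮2M = contradiction e<2M e≮2M

  par-legF : ∀ {e} → M + M ≤ e → par e ≡ legParent (M + M) attachF e
  par-legF {e} 2M≤e with e <? M
  ... | yes e<M = contradiction e<M (≤⇒≯ (≤-trans (m≤m+n M M) 2M≤e))
  ... | no _ with e <? M + M
  ...   | yes e<2M = contradiction e<2M (≤⇒≯ 2M≤e)
  ...   | no _     = refl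

  legEdge-≥ : ∀ O t l → O ≤ t * K + (O + l)
  legEdge-≥ O t l = ≤-trans (m≤m+n O l) (m≤n+m (O + l) (t * K))

  legEdge-< : ∀ O {t l} → t < K → l < K → t * K + (O + l) < O + M
  legEdge-< O {t} {l} t<K l<K = subst (_< O + M) (sym (swap O (t * K) l)) (+-monoʳ-< O (begin-strict
    t * K + l  <⟨ +-monoʳ-< (t * K) l<K ⟩
    t * K + K  ≡⟨ +-comm (t * K) K ⟩
    suc t * K  ≤⟨ *-monoˡ-≤ K t<K ⟩
    M          ∎))
    where
    open ≤-Reasoning
    swap : ∀ O x l → x + (O + l) ≡ O + (x + l)
    swap = solve-∀

  legParent-legEdge : ∀ O attach {l} t → l < K →
                      legParent O attach (t * K + (O + l)) ≡ legNode O attach l t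
  legParent-legEdge O attach {l} zero l<K with O + l <? O + K
  ... | yes _       = cong attach (m+n∸m≡n O l)
  ... | no l≮K      = contradiction (+-monoʳ-< O l<K) l≮K
  legParent-legEdge O attach {l} (suc t) _ with suc t * K + (O + l) <? O + K
  ... | yes e<O+K = contradiction e<O+K (≤⇒≯ (subst (O + K ≤_) (+-comm (O + l) (suc t * K))
                                                 (+-mono-≤ (m≤m+n O l) (m≤m+n K (t * K)))))
  ... | no _      = trans (cong (_∸ k) (shift k t O l)) (m+n∸m≡n k (suc (t * K + (O + l))))
    where
    shift : ∀ k t O l → suc t * suc k + (O + l) ≡ k + suc (t * suc k + (O + l))
    shift = solve-∀

  spine-distance : ∀ j → j + attachF (j % K) ≡ attachC (j / K)
  spine-distance j = begin
    j + (k ∸ r)            ≡⟨ cong (_+ (k ∸ r)) (m≡m%n+[m/n]*n j K) ⟩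
    (r + q * K) + (k ∸ r)  ≡⟨ rearrange r (q * K) (k ∸ r) ⟩
    ((k ∸ r) + r) + q * K  ≡⟨ cong (_+ q * K) (m∸n+n≡m (≤-pred (m%n<n j K))) ⟩
    k + q * K              ∎
    where
    open ≡-Reasoning
    r q : ℕ
    r = j % K
    q = j / K
    rearrange : ∀ x y z → (x + y) + z ≡ (z + x) + y
    rearrange = solve-∀

  M≤m : M ≤ m
  M≤m = ≤-trans (m≤m+n M M) (m≤m+n (M + M) M)

  module Labelled {s} (a b : Fin s) where

    lab : ℕ → Fin s
    lab e with e <? M
    ... | yes _ = b
    ... | no _  = a

    lab-spine : ∀ {e} → e < M → lab e ≡ b
    lab-spine {e} e<M with e <? M
    ... | yes _   = refl
    ... | no e≮M = contradiction e<M e≮M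

    lab-leg : ∀ {e} → M ≤ e → lab e ≡ a
    lab-leg {e} M≤e with e <? M
    ... | yes e<M = contradiction e<M (≤⇒≯ M≤e)
    ... | no _    = refl

    nodeAt : ℕ → Node m
    nodeAt e = e mod suc m

    edgeAt : ℕ → Fin m
    edgeAt e = e mod m

    toℕ-nodeAt : ∀ {e} → e ≤ m → toℕ (nodeAt e) ≡ e
    toℕ-nodeAt e≤m = toℕ-mod (s≤s e≤m)

    toℕ-edgeAt : ∀ {e} → e < m → toℕ (edgeAt e) ≡ e
    toℕ-edgeAt = toℕ-mod

    toℕ-legNode-suc : ∀ O {t l} → O + M ≤ m → t < K → l < K →
                      toℕ (nodeAt (suc (t * K + (O + l)))) ≡ suc (t * K + (O + l))
    toℕ-legNode-suc O O+M≤m t<K l<K = toℕ-nodeAt (<-≤-trans (legEdge-< O t<K l<K) O+M≤m)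

    toℕ-nodeAt-par : ∀ (i : Fin m) → toℕ (nodeAt (par (toℕ i))) ≡ par (toℕ i)
    toℕ-nodeAt-par i = toℕ-nodeAt (≤-trans (par-≤ (toℕ i)) (<⇒≤ (toℕ<n i)))

    tree : LTree s m
    tree = record
      { parent  = λ i → nodeAt (par (toℕ i))
      ; parent≤ = λ i → subst (_≤ toℕ i) (sym (toℕ-nodeAt-par i)) (par-≤ (toℕ i))
      ; label   = λ i → lab (toℕ i)
      }

    chainOf : ∀ {c len} (node edge : ℕ → ℕ) →
              (∀ {t} → t < len → edge t < m) →
              (∀ {t} → t < len → par (edge t) ≡ node t) →
              (∀ {t} → t < len → node (suc t) ≡ suc (edge t)) →
              (∀ {t} → t < len → lab (edge t) ≡ c) →
              Chain tree c len
    chainOf node edge edge<m par-edge node-suc lab-edge = record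
      { node        = nodeAt ∘ node
      ; edge        = edgeAt ∘ edge
      ; parent-edge = λ t<len → cong nodeAt (trans (cong par (toℕ-edgeAt (edge<m t<len))) (par-edge t<len))
      ; suc-edge    = λ t<len → trans
          (toℕ-injective (trans (cong suc (toℕ-edgeAt (edge<m t<len))) (sym (toℕ-nodeAt (edge<m t<len)))))
          (cong nodeAt (sym (node-suc t<len)))
      ; label-edge  = λ t<len → trans (cong lab (toℕ-edgeAt (edge<m t<len))) (lab-edge t<len)
      }

    spine : Chain tree b M
    spine = chainOf (λ t → t) (λ t → t) (λ t<M → <-≤-trans t<M M≤m) par-spine (λ _ → refl) lab-spine

    leg : ∀ O attach → (∀ {e} → O ≤ e → e < O + M → par e ≡ legParent O attach e) →
          M ≤ O → O + M ≤ m → ∀ {l} → l < K → Chain tree a K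
    leg O attach par-leg M≤O O+M≤m {l} l<K =
      chainOf (legNode O attach l) (λ t → t * K + (O + l))
        (λ t<K → <-≤-trans (legEdge-< O t<K l<K) O+M≤m)
        (λ {t} t<K → trans (par-leg (legEdge-≥ O t l) (legEdge-< O t<K l<K))
                           (legParent-legEdge O attach t l<K))
        (λ _ → refl)
        (λ {t} _ → lab-leg (≤-trans M≤O (legEdge-≥ O t l)))

    legC : ∀ {q} → q < K → Chain tree a K
    legC = leg M attachC par-legC ≤-refl (m≤m+n (M + M) M)

    legF : ∀ {l} → l < K → Chain tree a K
    legF = leg (M + M) attachF (λ 2M≤e _ → par-legF 2M≤e) (m≤m+n M M) ≤-refl

    two-letters : ∀ e → lab e ≡ a ⊎ lab e ≡ b
    two-letters e with e <? M
    ... | yes _ = inj₂ refl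
    ... | no _  = inj₁ refl

    upLabel-spine : ∀ v → toℕ v ≤ M → upLabel b tree v ≡ b
    upLabel-spine zero    _   = refl
    upLabel-spine (suc j) j<M = lab-spine j<M

    tree-InTk3 : a ≢ b → InTk 3 tree
    tree-InTk3 a≢b = upwardClosed⇒InTk3 tree a≢b (λ i → two-letters (toℕ i)) b-upward-closed
      where
      lab-b⇒spine : ∀ {e} → lab e ≡ b → e < M
      lab-b⇒spine {e} lab≡b with e <? M
      ... | yes e<M = e<M
      ... | no _    = ⊥-elim (a≢b lab≡b)
      b-upward-closed : ∀ i → label tree i ≡ b → upLabel b tree (parent tree i) ≡ b
      b-upward-closed i lab≡b = upLabel-spine _ (≤-trans (≤-reflexive parent≡i) (<⇒≤ i<M))
        where
        i<M : toℕ i < M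
        i<M = lab-b⇒spine lab≡b
        parent≡i : toℕ (parent tree i) ≡ toℕ i
        parent≡i = trans (toℕ-nodeAt-par i) (par-spine i<M)

    sandwich-path : ∀ {i j} → i < K → j < M → InLang tree (sandwich a b (suc i) j)
    sandwich-path {i} {j} i<K j<M =
      _ , _ , up ▻ along ▻ down ,
      valley⇒simple up (along ▻ down) (F.ascend-descending (suc i) i<K) up-above
                    (ascending⇒simple _ along▻down↑) along▻down-below
      where
      r q : ℕ
      r = j % K
      q = j / K
      r<K : r < K
      r<K = m%n<n j K
      q<K : q < K
      q<K = m<n*o⇒m/o<n j<M
      module F = Chain (legF r<K)
      module S = Chain spine
      module C = Chain (legC q<K)

      up : Walk tree (F.node (suc i)) (nodeAt (k ∸ r)) (replicate (suc i) a)
      up = F.ascend (suc i) i<K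

      along↑ : Σ (Walk tree (nodeAt (k ∸ r)) (nodeAt (attachC q)) (replicate j b)) Ascending
      along↑ = subst (λ e → Σ (Walk tree (nodeAt (k ∸ r)) (nodeAt e) (replicate j b)) Ascending)
                     (spine-distance j)
                     (S.descend (k ∸ r) j (subst (_≤ M) (sym (spine-distance j)) (<⇒≤ (attachC-< q<K))))

      down↑ : Σ (Walk tree (nodeAt (attachC q)) (C.node (suc i + 0)) (replicate (suc i) a)) Ascending
      down↑ = C.descend 0 (suc i) (subst (_≤ K) (sym (+-identityʳ (suc i))) i<K)

      along : Walk tree (nodeAt (k ∸ r)) (nodeAt (attachC q)) (replicate j b)
      along = proj₁ along↑
      down : Walk tree (nodeAt (attachC q)) (C.node (suc i + 0)) (replicate (suc i) a)
      down = proj₁ down↑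

      along▻down↑ : Ascending (along ▻ down)
      along▻down↑ = ascending-▻ along down (proj₂ along↑) (proj₂ down↑)

      up-above : All (λ v → M + M < toℕ v) (departures up)
      up-above = F.ascend-departures (suc i) i<K λ {t} t<1+i →
        subst (M + M <_) (sym (toℕ-legNode-suc (M + M) ≤-refl (<-≤-trans t<1+i i<K) r<K))
              (s≤s (legEdge-≥ (M + M) t r))

      along▻down-below : All (λ v → toℕ v ≤ M + M) (vertices (along ▻ down))
      along▻down-below =
        All.map (λ v≤tip → ≤-trans v≤tip tip≤) (ascending-upper (along ▻ down) along▻down↑)
        where
        i+0<K : i + 0 < K
        i+0<K = subst (_< K) (sym (+-identityʳ i)) (<-≤-trans (n<1+n i) i<K)
        tip≤ : toℕ (C.node (suc i + 0)) ≤ M + M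
        tip≤ = subst (_≤ M + M) (sym (toℕ-legNode-suc M (m≤m+n (M + M) M) i+0<K q<K))
                     (legEdge-< M i+0<K q<K)

    palindrome : ℕ × ℕ → Word s
    palindrome (i , j) = sandwich a b (suc i) j

    palindromes : List (Word s)
    palindromes = map palindrome (cartesianProduct (upTo K) (upTo M))

    length-palindromes : length palindromes ≡ K * M
    length-palindromes = begin
      length palindromes                           ≡⟨ length-map palindrome (cartesianProduct (upTo K) (upTo M)) ⟩
      length (cartesianProduct (upTo K) (upTo M))  ≡⟨ length-cartesianProduct (upTo K) (upTo M) ⟩
      length (upTo K) * length (upTo M)            ≡⟨ cong₂ _*_ (length-upTo K) (length-upTo M) ⟩
      K * M                                        ∎
      where open ≡-Reasoning

    palindromes-PalList : a ≢ b → PalList tree palindromes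
    palindromes-PalList a≢b =
      Uniqueₚ.map⁺ palindrome-injective (Uniqueₚ.cartesianProduct⁺ (Uniqueₚ.upTo⁺ K) (Uniqueₚ.upTo⁺ M)) ,
      Allₚ.map⁺ (All.tabulate λ {(i , j)} ij∈ →
        let i∈ , j∈ = ∈-cartesianProduct⁻ (upTo K) (upTo M) ij∈ in
        sandwich-path (∈-upTo⁻ i∈) (∈-upTo⁻ j∈) , sandwich-palindrome a b (suc i) j)
      where
      palindrome-injective : ∀ {p p′} → palindrome p ≡ palindrome p′ → p ≡ p′
      palindrome-injective {_ , _} {_ , _} eq =
        let i≡i′ , j≡j′ = sandwich-injective a≢b eq in cong₂ _,_ (suc-injective i≡i′) j≡j′

size : ℕ → ℕ
size = Construction.m

size-< : ∀ k → size k < size (suc k)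
size-< k = subst (size k <_) (sym (expand k)) (s≤s (m≤m+n (size k) (6 * k + 8)))
  where
  expand : ∀ k → ((2 + k) * (2 + k) + (2 + k) * (2 + k)) + (2 + k) * (2 + k)
               ≡ 1 + ((((1 + k) * (1 + k) + (1 + k) * (1 + k)) + (1 + k) * (1 + k)) + (6 * k + 8))
  expand = solve-∀

size-suc-≤ : ∀ k → size (suc k) ≤ 12 * (suc k * suc k)
size-suc-≤ k = begin
  size (suc k)                          ≡⟨ three-squares (suc (suc k)) ⟩
  3 * (suc (suc k) * suc (suc k))       ≤⟨ *-monoʳ-≤ 3 (*-mono-≤ 2+k≤2K 2+k≤2K) ⟩
  3 * ((K + K) * (K + K))               ≡⟨ four-squares K ⟩
  12 * (K * K)                          ∎
  where
  open ≤-Reasoning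
  K : ℕ
  K = suc k
  2+k≤2K : suc (suc k) ≤ K + K
  2+k≤2K = s≤s (m≤n+m K k)
  three-squares : ∀ x → (x * x + x * x) + x * x ≡ 3 * (x * x)
  three-squares = solve-∀
  four-squares : ∀ x → 3 * ((x + x) * (x + x)) ≡ 12 * (x * x)
  four-squares = solve-∀

cube-≤-square : ∀ n K → n ≤ 12 * (K * K) → n ^ 3 ≤ 42 ^ 2 * (K * (K * K)) ^ 2
cube-≤-square n K n≤ = begin
  n ^ 3                          ≤⟨ ^-monoˡ-≤ 3 n≤ ⟩
  (12 * (K * K)) ^ 3             ≡⟨ sixth-power K ⟩
  1728 * (K * (K * K)) ^ 2       ≤⟨ *-monoˡ-≤ ((K * (K * K)) ^ 2) (m≤m+n 1728 36) ⟩
  42 ^ 2 * (K * (K * K)) ^ 2     ∎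
  where
  open ≤-Reasoning
  sixth-power : ∀ K → let x = 12 * (K * K) ; y = K * (K * K) in
                x * (x * (x * 1)) ≡ 1728 * (y * (y * 1))
  sixth-power = solve-∀

theorem2 : (s : ℕ) → 2 ≤ s →
    ∃[ d ] (1 ≤ d × ∃[ N ] ((n : ℕ) → N ≤ n →
    ∃[ m ] (m ≤ n × Σ (LTree s m) λ T → InTk 3 T ×
    ∃[ ws ] (PalList T ws × n ^ 3 ≤ (d ^ 2) * (length ws ^ 2)))))
theorem2 (suc (suc s)) (s≤s (s≤s _)) = 42 , s≤s z≤n , size 0 , λ n size0≤n →
  let k , size≤n , n<size = floor-inverse size size-< n size0≤n in
  size k , size≤n , T.tree k , T.tree-InTk3 k a≢b , T.palindromes k , T.palindromes-PalList k a≢b ,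
  subst (λ l → n ^ 3 ≤ 42 ^ 2 * l ^ 2) (sym (T.length-palindromes k))
        (cube-≤-square n (suc k) (≤-trans (<⇒≤ n<size) (size-suc-≤ k)))
  where
  a b : Fin (suc (suc s))
  a = zero
  b = suc zero
  a≢b : a ≢ b
  a≢b ()
  module T (k : ℕ) = Construction.Labelled k a b
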